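{- Let $P$ be a set of ports and $X=P\cup\dot P\cup\overline P$. For all $a,b\subseteq X$ with $\dot{\mathrm{sup}}(b)=\emptyset$, the equality of causal interaction trees $a\rightarrow b=a$ is derivable from the axioms (A1)–(A7).
   Context: $\dot P=\{\dot p:p\in P\}$ (firing typings), $P$ (activation typings), $\overline P=\{\overline p:p\in P\}$ (negative typings); for $a\subseteq X$, $\dot{\mathrm{sup}}(a)=\{p\in P:\dot p\in a\}$. Causal interaction trees over $X$ are generated by $t::=a\mid a\rightarrow t\mid t\oplus t$, where a node $a$ is an interaction $a\subseteq X$ (the empty interaction denoted $1$) or the constant $0$; $\rightarrow$ is right-associative and binds stronger than $\oplus$. For nodes, $a\cdot b=ab$ denotes $a\cup b$ ($ap=a\cup\{p\}$), with $0$ absorbing. Axioms: (A1) for $p\in P$ and nonempty $a\subseteq X$: $a\cdot0=0$; $a\cdot1=a$ for $a\ne0$; $\dot p\cdot p=\dot p$; $\dot p\cdot\overline p=p\cdot\overline p=0$. (A2) $\oplus$ is associative, commutative, idempotent with identity $0$. (A3) $a\rightarrow0=a$. (A4) $0\rightarrow t=0$. (A5) $c\rightarrow a\rightarrow b\rightarrow t=c\rightarrow ab\rightarrow t$ whenever $\dot{\mathrm{sup}}(a)=\emptyset$. (A6) $ap\rightarrow b=ap\rightarrow bp$ for $p\in X$. (A7) $a\rightarrow(t_1\oplus t_2)=(a\rightarrow t_1)\oplus(a\rightarrow t_2)$. Equalities are derived by equational reasoning (substitution in any context). -}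

module Defs where

open import Level using (0ℓ)
open import Data.Product using (∃; _,_)
open import Data.Sum using (_⊎_)
open import Relation.Nullary using (¬_)
open import Relation.Unary using (Pred; _∪_; ∅; ｛_｝)
open import Relation.Binary.PropositionalEquality using (_≡_)

-- X = P ∪ Ṗ ∪ P̄ : activation, firing and negative typings of ports.
data X (P : Set) : Set where
  act : P → X P
  dot : P → X P
  neg : P → X P

Interaction : Set → Set₁
Interaction P = Pred (X P) 0ℓ

data Node (P : Set) : Set₁ where
  𝟘  : Node P
  ⟦_⟧ : Interaction P → Node P

𝟙 : {P : Set} → Node P
𝟙 = ⟦ ∅ ⟧

_·_ : {P : Set} → Node P → Node P → Node P
𝟘 · _ = 𝟘
⟦ a ⟧ · 𝟘 = 𝟘
⟦ a ⟧ · ⟦ b ⟧ = ⟦ a ∪ b ⟧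

infixl 7 _·_

NoFiring : {P : Set} → Interaction P → Set
NoFiring {P} a = (p : P) → ¬ a (dot p)

Nonempty : {P : Set} → Interaction P → Set
Nonempty a = ∃ λ x → a x

data Tree (P : Set) : Set₁ where
  node : Node P → Tree P
  _⇒_  : Node P → Tree P → Tree P
  _⊕_  : Tree P → Tree P → Tree P

infixr 6 _⇒_
infixl 5 _⊕_

data _≈ₙ_ {P : Set} : Node P → Node P → Set₁ where
  n-refl  : ∀ {a} → a ≈ₙ a
  n-sym   : ∀ {a b} → a ≈ₙ b → b ≈ₙ a
  n-trans : ∀ {a b c} → a ≈ₙ b → b ≈ₙ c → a ≈ₙ c
  n-ext   : ∀ {a b : Interaction P} → (∀ x → a x → b x) → (∀ x → b x → a x) → ⟦ a ⟧ ≈ₙ ⟦ b ⟧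
  n-cong  : ∀ {l r} (c : Node P) → l ≈ₙ r → (c · l) ≈ₙ (c · r)
  A1-zero    : ∀ {a : Interaction P} → Nonempty a → (⟦ a ⟧ · 𝟘) ≈ₙ 𝟘
  A1-one     : ∀ {a : Interaction P} → (⟦ a ⟧ · 𝟙) ≈ₙ ⟦ a ⟧
  A1-dot-act : ∀ (p : P) → (⟦ ｛ dot p ｝ ⟧ · ⟦ ｛ act p ｝ ⟧) ≈ₙ ⟦ ｛ dot p ｝ ⟧
  A1-dot-neg : ∀ (p : P) → (⟦ ｛ dot p ｝ ⟧ · ⟦ ｛ neg p ｝ ⟧) ≈ₙ 𝟘
  A1-act-neg : ∀ (p : P) → (⟦ ｛ act p ｝ ⟧ · ⟦ ｛ neg p ｝ ⟧) ≈ₙ 𝟘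

infix 4 _≈ₙ_ _≈_

data _≈_ {P : Set} : Tree P → Tree P → Set₁ where
  refl   : ∀ {t} → t ≈ t
  sym    : ∀ {t u} → t ≈ u → u ≈ t
  trans  : ∀ {t u v} → t ≈ u → u ≈ v → t ≈ v
  node-cong : ∀ {a b} → a ≈ₙ b → node a ≈ node b
  ⇒-cong : ∀ {a b t u} → a ≈ₙ b → t ≈ u → (a ⇒ t) ≈ (b ⇒ u)
  ⊕-cong : ∀ {t t' u u'} → t ≈ t' → u ≈ u' → (t ⊕ u) ≈ (t' ⊕ u')
  -- (A2)
  ⊕-assoc : ∀ t u v → ((t ⊕ u) ⊕ v) ≈ (t ⊕ (u ⊕ v))
  ⊕-comm  : ∀ t u → (t ⊕ u) ≈ (u ⊕ t)
  ⊕-idem  : ∀ t → (t ⊕ t) ≈ t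
  ⊕-id    : ∀ t → (t ⊕ node 𝟘) ≈ t
  A3 : ∀ a → (a ⇒ node 𝟘) ≈ node a
  A4 : ∀ t → (𝟘 ⇒ t) ≈ node 𝟘
  A5 : ∀ (c : Node P) (a : Interaction P) (b : Node P) t → NoFiring a →
       (c ⇒ ⟦ a ⟧ ⇒ b ⇒ t) ≈ (c ⇒ (⟦ a ⟧ · b) ⇒ t)
  A6 : ∀ (a : Node P) (p : X P) (b : Node P) →
       ((a · ⟦ ｛ p ｝ ⟧) ⇒ node b) ≈ ((a · ⟦ ｛ p ｝ ⟧) ⇒ node (b · ⟦ ｛ p ｝ ⟧))
  A7 : ∀ a t₁ t₂ → (a ⇒ (t₁ ⊕ t₂)) ≈ ((a ⇒ t₁) ⊕ (a ⇒ t₂))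

module Submission where

open import Level using (suc; 0ℓ)
open import Relation.Binary.Bundles using (Setoid)
open import Defs

tree-setoid : Set → Setoid (suc 0ℓ) (suc 0ℓ)
tree-setoid P = record
  { Carrier = Tree P
  ; _≈_ = _≈_
  ; isEquivalence = record { refl = refl ; sym = sym ; trans = trans }
  }

-- Pad b with a dead continuation, then let (A5) merge b into it: b · 0 = 0.
lemma3 : (P : Set) (a b : Interaction P) → NoFiring b →
    (⟦ a ⟧ ⇒ node ⟦ b ⟧) ≈ node ⟦ a ⟧
lemma3 P a b noFiring = begin
  ⟦ a ⟧ ⇒ node ⟦ b ⟧               ≈⟨ ⇒-cong n-refl (sym (A3 ⟦ b ⟧)) ⟩
  ⟦ a ⟧ ⇒ ⟦ b ⟧ ⇒ node 𝟘           ≈⟨ ⇒-cong n-refl (⇒-cong n-refl (sym (A4 (node 𝟘)))) ⟩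
  ⟦ a ⟧ ⇒ ⟦ b ⟧ ⇒ 𝟘 ⇒ node 𝟘       ≈⟨ A5 ⟦ a ⟧ b 𝟘 (node 𝟘) noFiring ⟩
  ⟦ a ⟧ ⇒ (⟦ b ⟧ · 𝟘) ⇒ node 𝟘     ≈⟨ ⇒-cong n-refl (A4 (node 𝟘)) ⟩
  ⟦ a ⟧ ⇒ node 𝟘                   ≈⟨ A3 ⟦ a ⟧ ⟩
  node ⟦ a ⟧                       ∎
  where open import Relation.Binary.Reasoning.Setoid (tree-setoid P)
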